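{- Let $\mathbf c,\mathbf c'$ be linear orders on $c_1,\dots,c_t$ whose canonical sequences $\mathbf r=(r_1\le r_2\le\dots\le r_t)$ and $\mathbf s=(s_1\le s_2\le\dots\le s_t)$ are both nondecreasing and are distinct. Then there is a label $k\in\{1,\dots,t+1\}$ such that the number of vertices of label $k$ in $\mathscr G(\mathbf c)$ differs from that in $\mathscr G(\mathbf c')$.
   Context: Let $T=\{1,\dots,t\}$. A linear order $\mathbf c$ on symbols $c_1,\dots,c_t$ determines a labelled graph $\mathscr G(\mathbf c)$ (vertices labelled in $\{1,\dots,t+1\}$, edges labelled in $T$), defined inductively. For $t=1$: two vertices labelled $1$ and $2$ joined by an edge labelled $1$. For $t\ge2$: let $c_s$ be the maximal element of $\mathbf c$. Let $\mathbf c'$ be the induced order on $\mathbf c\setminus\{c_s\}$, reindexed by keeping indices $<s$ and decreasing indices $>s$ by $1$; let $\mathscr G'=\mathscr G(\mathbf c')$. Let $\mathscr G^+$ be a copy of $\mathscr G'$ in which every label (on vertices and edges) $\ell\le s-1$ is kept and every label $\ell\ge s$ is replaced by $\ell+1$. Let $\mathscr G^-$ be a second copy of the same underlying graph, with $\varphi:\mathscr G^+\to\mathscr G^-$ the identification, carrying the same labels except that vertices labelled $s+1$ in $\mathscr G^+$ are labelled $s$ in $\mathscr G^-$. Then $\mathscr G(\mathbf c)$ is the disjoint union of $\mathscr G^+$ and $\mathscr G^-$ together with, for each vertex $v$ of $\mathscr G^+$ of label $s+1$, an edge labelled $s$ joining $v$ and $\varphi(v)$. Canonical sequence of $\mathbf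 c$: let $(k_1,\dots,k_t)$ be the permutation of $T$ with $c_{k_1}<\dots<c_{k_t}$, and set $n(k_i)=k_i-|\{j>i: k_j<k_i\}|$; the canonical sequence is $(n(k_1),\dots,n(k_t))$. -}

module Defs where

open import Data.Nat using (ℕ; zero; suc; _+_; _∸_; _≤_; _<_; _<ᵇ_; _≡ᵇ_)
open import Data.Nat.Properties using (_≟_; _<?_)
open import Data.Bool using (Bool; true; false; if_then_else_)
open import Data.List using (List; []; _∷_; _++_; map; length; filter; upTo; zip)
open import Data.Product using (_×_; _,_)

-- A linear order c on the symbols c_1,…,c_t is represented by the list
-- (k_1,…,k_t) of indices listed in increasing c-order: c_{k_1} < … < c_{k_t}.
-- (Well-formedness: the list is a permutation of (1,…,t); see Statement.)
LinOrder : Set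
LinOrder = List ℕ

-- A finite labelled graph: vertices are 0,…,n-1 (n = length vlabels) with
-- vertex labels vlabels; edges are triples (u , v , label).
record Graph : Set where
  constructor mkGraph
  field
    vlabels : List ℕ
    edges   : List (ℕ × ℕ × ℕ)
open Graph public

lastOr : ℕ → List ℕ → ℕ
lastOr d []       = d
lastOr d (x ∷ xs) = lastOr x xs

dropLast : List ℕ → List ℕ
dropLast []           = []
dropLast (x ∷ [])     = []
dropLast (x ∷ y ∷ xs) = x ∷ dropLast (y ∷ xs)

reindex : ℕ → ℕ → ℕ
reindex s k = if k <ᵇ s then k else k ∸ 1

shiftLab : ℕ → ℕ → ℕ
shiftLab s ℓ = if ℓ <ᵇ s then ℓ else suc ℓ

lowerLab : ℕ → ℕ → ℕ
lowerLab s ℓ = if ℓ ≡ᵇ suc s then s else ℓ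

mapEdgeLab : (ℕ → ℕ) → ℕ × ℕ × ℕ → ℕ × ℕ × ℕ
mapEdgeLab f (u , v , ℓ) = (u , v , f ℓ)

shiftEdge : ℕ → ℕ × ℕ × ℕ → ℕ × ℕ × ℕ
shiftEdge n (u , v , ℓ) = (u + n , v + n , ℓ)

-- the new edges labelled s joining v (of label s+1 in 𝒢⁺) to φ(v) = v + n
newEdges : ℕ → ℕ → List (ℕ × ℕ) → List (ℕ × ℕ × ℕ)
newEdges s n []              = []
newEdges s n ((i , ℓ) ∷ xs) =
  if ℓ ≡ᵇ suc s then (i , i + n , s) ∷ newEdges s n xs else newEdges s n xs

-- the inductive step: from 𝒢' = 𝒢(c') and s, build 𝒢(c)
step : ℕ → Graph → Graph
step s G' = mkGraph (labsP ++ labsM) (edgesP ++ map (shiftEdge n) edgesP ++ newEdges s n (zip (upTo n) labsP))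
  where
    labsP  = map (shiftLab s) (vlabels G')
    labsM  = map (lowerLab s) labsP
    edgesP = map (mapEdgeLab (shiftLab s)) (edges G')
    n      = length labsP

-- 𝒢(c) for an order on t symbols (first argument t, used as recursion measure)
𝒢 : ℕ → LinOrder → Graph
𝒢 zero          ks = mkGraph [] []
𝒢 (suc zero)    ks = mkGraph (1 ∷ 2 ∷ []) ((0 , 1 , 1) ∷ [])
𝒢 (suc (suc t)) ks = step s (𝒢 (suc t) (map (reindex s) (dropLast ks)))
  where s = lastOr 0 ks

#vertices : ℕ → Graph → ℕ
#vertices k G = length (filter (k ≟_) (vlabels G))

canonical : LinOrder → List ℕ
canonical []       = []
canonical (k ∷ ks) = (k ∸ length (filter (_<? k) ks)) ∷ canonical ks

oneTo : ℕ → List ℕ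
oneTo t = map suc (upTo t)

module Submission where

-- Write s = top c for the maximal symbol of c, prev c for the reindexed order
-- on the other symbols, and f, g for the label profiles (k ↦ number of
-- vertices of label k) of 𝒢(prev c) and 𝒢(c) = step s 𝒢(prev c).
-- The map shiftLab s opens a gap at s, and lowering s+1 to s
-- after it opens a gap at s+1 instead, so counting labels through step gives
--   g k = 2 f k (k < s),   g s = g (s+1) = f s,   g (j+1) = 2 f j (s < j).
-- The canonical sequence of c is that of prev c followed by s, so for a
-- nondecreasing canonical sequence an induction shows that the profile of
-- 𝒢(c) is flat from s to s+1 and strictly increasing afterwards
-- (profile-rises; it also needs that every label occurs, profile-positive).
-- For the theorem, induct on t: if the tops of c and c′ differ, the profile
-- flat at the larger top is strictly increasing there in the other graph; if
-- they agree, the previous orders have distinct canonical sequences, and a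
-- difference of the previous profiles survives the step (step-separates).

open import Defs
open import Data.Nat using (ℕ; zero; suc; _+_; _*_; _∸_; _≤_; _<_; _<ᵇ_; _≡ᵇ_; z≤n; s≤s)
open import Data.Nat.Properties
open import Data.Bool using (true; false)
open import Data.List using (List; []; _∷_; _++_; [_]; map; length; filter; upTo)
open import Data.List.Properties
  using (length-++; filter-++; filter-accept; filter-reject; filter-none; map-∘; map-cong; map-id-local; length-map; length-upTo; ++-assoc)
open import Data.List.Relation.Unary.All as All using (All; []; _∷_)
import Data.List.Relation.Unary.All.Properties as AllP
open import Data.List.Relation.Unary.AllPairs using (_∷_)
open import Data.List.Relation.Unary.Linked using (Linked; []; [-]; _∷_)
import Data.List.Relation.Unary.Linked as Linked
open import Data.List.Relation.Unary.Unique.Propositional using (Unique)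
import Data.List.Relation.Unary.Unique.Propositional.Properties as UniqueP
open import Data.List.Relation.Binary.Permutation.Propositional using (_↭_; ↭-sym; ↭⇒↭ₛ)
open import Data.List.Relation.Binary.Permutation.Propositional.Properties using (↭-length; All-resp-↭; ++-comm)
open import Data.Product using (∃-syntax; _×_; _,_; proj₁; proj₂)
open import Data.Sum using (inj₁; inj₂)
open import Data.Empty using (⊥-elim)
open import Function using (_⇔_; mk⇔; Equivalence)
open import Relation.Nullary using (yes; no)
open import Relation.Unary using (Pred; Decidable)
open import Level using (0ℓ)
open import Relation.Binary.Definitions using (tri<; tri≈; tri>)
open import Relation.Binary.PropositionalEquality hiding ([_])
open import Data.List.Relation.Binary.Permutation.Setoid.Properties (setoid ℕ) using (Unique-resp-↭)

shiftLab-< : ∀ {p x} → x < p → shiftLab p x ≡ x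
shiftLab-< {p} {x} x<p with x <ᵇ p | <⇒<ᵇ x<p
... | true | _ = refl

shiftLab-≥ : ∀ {p x} → p ≤ x → shiftLab p x ≡ suc x
shiftLab-≥ {p} {x} p≤x with x <ᵇ p | <ᵇ⇒< x p
... | false | _   = refl
... | true  | x<p = ⊥-elim (<⇒≱ (x<p _) p≤x)

reindex-< : ∀ {p x} → x < p → reindex p x ≡ x
reindex-< {p} {x} x<p with x <ᵇ p | <⇒<ᵇ x<p
... | true | _ = refl

reindex-above : ∀ {p j} → p ≤ j → reindex p (suc j) ≡ j
reindex-above {p} {j} p≤j with suc j <ᵇ p | <ᵇ⇒< (suc j) p
... | false | _    = refl
... | true  | j<p = ⊥-elim (<⇒≱ (j<p _) (m≤n⇒m≤1+n p≤j))

lowerLab-hit : ∀ s → lowerLab s (suc s) ≡ s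
lowerLab-hit s with suc s ≡ᵇ suc s | ≡⇒≡ᵇ (suc s) (suc s) refl
... | true | _ = refl

lowerLab-miss : ∀ {s y} → y ≢ suc s → lowerLab s y ≡ y
lowerLab-miss {s} {y} y≢ with y ≡ᵇ suc s | ≡ᵇ⇒≡ y (suc s)
... | false | _  = refl
... | true  | eq = ⊥-elim (y≢ (eq _))

-- Lowering after opening a gap at s amounts to opening the gap at s+1:
-- this is why the copy 𝒢⁻ has the same profile as a gap at s+1.
lowerLab-shiftLab : ∀ s x → lowerLab s (shiftLab s x) ≡ shiftLab (suc s) x
lowerLab-shiftLab s x with <-cmp x s
... | tri< x<s _ _ = begin
  lowerLab s (shiftLab s x) ≡⟨ cong (lowerLab s) (shiftLab-< x<s) ⟩
  lowerLab s x              ≡⟨ lowerLab-miss (<⇒≢ (m<n⇒m<1+n x<s)) ⟩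
  x                         ≡⟨ sym (shiftLab-< (m<n⇒m<1+n x<s)) ⟩
  shiftLab (suc s) x        ∎
  where open ≡-Reasoning
... | tri≈ _ refl _ = begin
  lowerLab s (shiftLab s s) ≡⟨ cong (lowerLab s) (shiftLab-≥ ≤-refl) ⟩
  lowerLab s (suc s)        ≡⟨ lowerLab-hit s ⟩
  s                         ≡⟨ sym (shiftLab-< (n<1+n s)) ⟩
  shiftLab (suc s) s        ∎
  where open ≡-Reasoning
... | tri> _ _ s<x = begin
  lowerLab s (shiftLab s x) ≡⟨ cong (lowerLab s) (shiftLab-≥ (<⇒≤ s<x)) ⟩
  lowerLab s (suc x)        ≡⟨ lowerLab-miss (λ e → >⇒≢ s<x (suc-injective e)) ⟩
  suc x                     ≡⟨ sym (shiftLab-≥ s<x) ⟩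
  shiftLab (suc s) x        ∎
  where open ≡-Reasoning

reindex-shiftLab : ∀ p x → reindex p (shiftLab p x) ≡ x
reindex-shiftLab p x with x <? p
... | yes x<p = trans (cong (reindex p) (shiftLab-< x<p)) (reindex-< x<p)
... | no  x≮p = trans (cong (reindex p) (shiftLab-≥ (≮⇒≥ x≮p))) (reindex-above (≮⇒≥ x≮p))

shiftLab-reindex : ∀ {p x} → p ≢ x → shiftLab p (reindex p x) ≡ x
shiftLab-reindex {p} {x} p≢x with <-cmp x p
... | tri< x<p _ _ = trans (cong (shiftLab p) (reindex-< x<p)) (shiftLab-< x<p)
... | tri≈ _ x≡p _ = ⊥-elim (p≢x (sym x≡p))
shiftLab-reindex {p} {suc j} _ | tri> _ _ (s≤s p≤j) =
  trans (cong (shiftLab p) (reindex-above p≤j)) (shiftLab-≥ p≤j)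

shiftLab-injective : ∀ p {x y} → shiftLab p x ≡ shiftLab p y → x ≡ y
shiftLab-injective p {x} {y} e =
  trans (sym (reindex-shiftLab p x)) (trans (cong (reindex p) e) (reindex-shiftLab p y))

shiftLab-avoids : ∀ p x → p ≢ shiftLab p x
shiftLab-avoids p x with x <? p
... | yes x<p = λ e → >⇒≢ x<p (trans e (shiftLab-< x<p))
... | no  x≮p = λ e → <⇒≢ (s≤s (≮⇒≥ x≮p)) (trans e (shiftLab-≥ (≮⇒≥ x≮p)))

shiftLab-inflationary : ∀ p x → x ≤ shiftLab p x
shiftLab-inflationary p x with x <? p
... | yes x<p = ≤-reflexive (sym (shiftLab-< x<p))
... | no  x≮p = ≤-trans (n≤1+n x) (≤-reflexive (sym (shiftLab-≥ (≮⇒≥ x≮p))))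

shiftLab-mono : ∀ p {x y} → x < y → shiftLab p x < shiftLab p y
shiftLab-mono p {x} {y} x<y with x <? p
... | yes x<p = subst (_< shiftLab p y) (sym (shiftLab-< x<p)) (<-≤-trans x<y (shiftLab-inflationary p y))
... | no  x≮p = subst₂ _<_ (sym (shiftLab-≥ (≮⇒≥ x≮p))) (sym (shiftLab-≥ (≤-trans (≮⇒≥ x≮p) (<⇒≤ x<y)))) (s≤s x<y)

reindex-reflects-< : ∀ {p x k} → p ≢ x → p ≢ k → reindex p x < reindex p k → x < k
reindex-reflects-< {p} p≢x p≢k r< =
  subst₂ _<_ (shiftLab-reindex p≢x) (shiftLab-reindex p≢k) (shiftLab-mono p r<)

reindex-<-iff : ∀ {p x k} → p ≢ x → p ≢ k → (reindex p x < reindex p k ⇔ x < k)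
reindex-<-iff {p} {x} {k} p≢x p≢k = mk⇔ (reindex-reflects-< p≢x p≢k) preserve
  where
    preserve : x < k → reindex p x < reindex p k
    preserve x<k with <-cmp (reindex p x) (reindex p k)
    ... | tri< r< _ _ = r<
    ... | tri≈ _ r≡ _ = ⊥-elim (<⇒≢ x<k (trans (sym (shiftLab-reindex p≢x))
                                  (trans (cong (shiftLab p) r≡) (shiftLab-reindex p≢k))))
    ... | tri> _ _ r> = ⊥-elim (<-asym x<k (reindex-reflects-< p≢k p≢x r>))

InRange : ℕ → ℕ → Set
InRange n x = 1 ≤ x × x ≤ n

reindex-range : ∀ {n s x} → InRange (suc n) s → InRange (suc n) x → s ≢ x → InRange n (reindex s x)
reindex-range {n} {s} {x} (1≤s , s≤) (1≤x , x≤) s≢x with <-cmp x s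
... | tri< x<s _ _ = subst (InRange n) (sym (reindex-< x<s)) (1≤x , ≤-pred (≤-trans x<s s≤))
... | tri≈ _ x≡s _ = ⊥-elim (s≢x (sym x≡s))
reindex-range {n} {s} {suc j} (1≤s , _) (_ , s≤s j≤n) _ | tri> _ _ (s≤s s≤j) =
  subst (InRange n) (sym (reindex-above s≤j)) (≤-trans 1≤s s≤j , j≤n)

count : ℕ → List ℕ → ℕ
count k xs = length (filter (k ≟_) xs)

profile : Graph → ℕ → ℕ
profile G k = #vertices k G

filter-length-map : ∀ {A B : Set} {P : Pred B 0ℓ} {Q : Pred A 0ℓ} (P? : Decidable P) (Q? : Decidable Q) (f : A → B) {xs : List A} →
  All (λ x → P (f x) ⇔ Q x) xs → length (filter P? (map f xs)) ≡ length (filter Q? xs)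
filter-length-map P? Q? f [] = refl
filter-length-map P? Q? f {x ∷ xs} (Pfx⇔Qx ∷ rest) with P? (f x) | Q? x
... | yes _   | yes _   = cong suc (filter-length-map P? Q? f rest)
... | yes Pfx | no ¬Qx  = ⊥-elim (¬Qx (Equivalence.to Pfx⇔Qx Pfx))
... | no ¬Pfx | yes Qx  = ⊥-elim (¬Pfx (Equivalence.from Pfx⇔Qx Qx))
... | no _    | no _    = filter-length-map P? Q? f rest

count-map-injective : ∀ {f : ℕ → ℕ} → (∀ {x y} → f x ≡ f y → x ≡ y) → ∀ j xs → count (f j) (map f xs) ≡ count j xs
count-map-injective {f} f-injective j xs =
  filter-length-map (f j ≟_) (j ≟_) f (All.universal (λ x → mk⇔ f-injective (cong f)) xs)

count-map-missing : ∀ {f : ℕ → ℕ} {k} → (∀ x → k ≢ f x) → ∀ xs → count k (map f xs) ≡ 0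
count-map-missing {k = k} missing xs =
  cong length (filter-none (k ≟_) (AllP.map⁺ (All.universal missing xs)))

count-gap-below : ∀ {p k} → k < p → ∀ xs → count k (map (shiftLab p) xs) ≡ count k xs
count-gap-below {p} {k} k<p xs =
  trans (cong (λ y → count y (map (shiftLab p) xs)) (sym (shiftLab-< k<p)))
        (count-map-injective (shiftLab-injective p) k xs)

count-gap : ∀ p xs → count p (map (shiftLab p) xs) ≡ 0
count-gap p = count-map-missing (shiftLab-avoids p)

count-gap-above : ∀ {p k} → p ≤ k → ∀ xs → count (suc k) (map (shiftLab p) xs) ≡ count k xs
count-gap-above {p} {k} p≤k xs =
  trans (cong (λ y → count y (map (shiftLab p) xs)) (sym (shiftLab-≥ p≤k)))
        (count-map-injective (shiftLab-injective p) k xs)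

count-step : ∀ s G k →
  profile (step s G) k ≡ count k (map (shiftLab s) (vlabels G)) + count k (map (shiftLab (suc s)) (vlabels G))
count-step s G k = begin
  length (filter (k ≟_) (A ++ map (lowerLab s) A))
    ≡⟨ cong length (filter-++ (k ≟_) A (map (lowerLab s) A)) ⟩
  length (filter (k ≟_) A ++ filter (k ≟_) (map (lowerLab s) A))
    ≡⟨ length-++ (filter (k ≟_) A) ⟩
  count k A + count k (map (lowerLab s) A)
    ≡⟨ cong (λ ys → count k A + count k ys) lowered ⟩
  count k A + count k (map (shiftLab (suc s)) (vlabels G)) ∎
  where
    open ≡-Reasoning
    A : List ℕ
    A = map (shiftLab s) (vlabels G)
    lowered : map (lowerLab s) A ≡ map (shiftLab (suc s)) (vlabels G)
    lowered = trans (sym (map-∘ (vlabels G))) (map-cong (lowerLab-shiftLab s) (vlabels G))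

-- Doubling, in the form produced by adding the two copies 𝒢⁺ and 𝒢⁻.
twice : ∀ m → m + m ≡ 2 * m
twice m = cong (m +_) (sym (+-identityʳ m))

step-below : ∀ G {s k} → k < s → profile (step s G) k ≡ 2 * profile G k
step-below G {s} {k} k<s = trans (count-step s G k)
  (trans (cong₂ _+_ (count-gap-below k<s (vlabels G)) (count-gap-below (m<n⇒m<1+n k<s) (vlabels G))) (twice (profile G k)))

step-at : ∀ G {s} → profile (step s G) s ≡ profile G s
step-at G {s} = trans (count-step s G s)
  (cong₂ _+_ (count-gap s (vlabels G)) (count-gap-below (n<1+n s) (vlabels G)))

step-after : ∀ G {s} → profile (step s G) (suc s) ≡ profile G s
step-after G {s} = trans (count-step s G (suc s))
  (trans (cong₂ _+_ (count-gap-above ≤-refl (vlabels G)) (count-gap (suc s) (vlabels G))) (+-identityʳ _))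

step-above : ∀ G {s j} → s < j → profile (step s G) (suc j) ≡ 2 * profile G j
step-above G {s} {j} s<j = trans (count-step s G (suc j))
  (trans (cong₂ _+_ (count-gap-above (<⇒≤ s<j) (vlabels G)) (count-gap-above s<j (vlabels G))) (twice (profile G j)))

Arrangement : ℕ → LinOrder → Set
Arrangement n c = length c ≡ n × All (InRange n) c × Unique c

arrangement-resp-↭ : ∀ {n xs ys} → xs ↭ ys → Arrangement n xs → Arrangement n ys
arrangement-resp-↭ xs↭ys (len , range , unique) =
  trans (sym (↭-length xs↭ys)) len , All-resp-↭ xs↭ys range , Unique-resp-↭ (↭⇒↭ₛ xs↭ys) unique

oneTo-arrangement : ∀ n → Arrangement n (oneTo n)
oneTo-arrangement n =
  trans (length-map suc (upTo n)) (length-upTo n) ,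
  AllP.map⁺ (All.map (λ x<n → s≤s z≤n , x<n) (AllP.all-upTo n)) ,
  UniqueP.map⁺ suc-injective (UniqueP.upTo⁺ n)

top : LinOrder → ℕ
top c = lastOr 0 c

prev : LinOrder → LinOrder
prev c = map (reindex (top c)) (dropLast c)

dropLast-top : ∀ x xs → dropLast (x ∷ xs) ++ [ top (x ∷ xs) ] ≡ x ∷ xs
dropLast-top x []       = refl
dropLast-top x (y ∷ ys) = cong (x ∷_) (dropLast-top y ys)

#below : ℕ → List ℕ → ℕ
#below k xs = length (filter (_<? k) xs)

reindex-by-count : ∀ {s k} → s ≢ k → reindex s k ≡ k ∸ #below k [ s ]
reindex-by-count {s} {k} s≢k with <-cmp k s
... | tri< k<s _ _ = trans (reindex-< k<s) (cong (λ ys → k ∸ length ys) (sym (filter-reject (_<? k) (<⇒≯ k<s))))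
... | tri≈ _ k≡s _ = ⊥-elim (s≢k (sym k≡s))
reindex-by-count {s} {suc j} _ | tri> _ _ s<k@(s≤s s≤j) =
  trans (reindex-above s≤j) (cong (λ ys → suc j ∸ length ys) (sym (filter-accept (_<? suc j) s<k)))

-- Removing the maximal symbol s does not change the canonical entries of the others.
rank-snoc : ∀ s k xs → s ≢ k → All (s ≢_) xs →
  k ∸ #below k (xs ++ [ s ]) ≡ reindex s k ∸ #below (reindex s k) (map (reindex s) xs)
rank-snoc s k xs s≢k s∉xs = begin
  k ∸ #below k (xs ++ [ s ])
    ≡⟨ cong (λ ys → k ∸ length ys) (filter-++ (_<? k) xs [ s ]) ⟩
  k ∸ length (filter (_<? k) xs ++ filter (_<? k) [ s ])
    ≡⟨ cong (k ∸_) (trans (length-++ (filter (_<? k) xs)) (+-comm (#below k xs) _)) ⟩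
  k ∸ (#below k [ s ] + #below k xs)
    ≡⟨ sym (∸-+-assoc k (#below k [ s ]) (#below k xs)) ⟩
  k ∸ #below k [ s ] ∸ #below k xs
    ≡⟨ cong₂ _∸_ (sym (reindex-by-count s≢k)) (sym reindexed-below) ⟩
  reindex s k ∸ #below (reindex s k) (map (reindex s) xs) ∎
  where
    open ≡-Reasoning
    reindexed-below : #below (reindex s k) (map (reindex s) xs) ≡ #below k xs
    reindexed-below = filter-length-map (_<? reindex s k) (_<? k) (reindex s)
      (All.map (λ s≢x → reindex-<-iff s≢x s≢k) s∉xs)

canonical-snoc : ∀ s xs → All (s ≢_) xs → canonical (xs ++ [ s ]) ≡ canonical (map (reindex s) xs) ++ [ s ]
canonical-snoc s []       []               = refl
canonical-snoc s (k ∷ xs) (s≢k ∷ s∉xs) = cong₂ _∷_ (rank-snoc s k xs s≢k s∉xs) (canonical-snoc s xs s∉xs)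

decompose : ∀ {n c} → Arrangement (suc n) c →
  Arrangement n (prev c) × InRange (suc n) (top c) × canonical c ≡ canonical (prev c) ++ [ top c ]
decompose {c = []} (() , _)
decompose {n} {x ∷ xs} arrangement
  with arrangement-resp-↭ (++-comm (dropLast (x ∷ xs)) [ top (x ∷ xs) ])
         (subst (Arrangement (suc n)) (sym (dropLast-top x xs)) arrangement)
... | len , s-range ∷ ys-range , s∉ys ∷ ys-unique =
  (trans (length-map (reindex s) ys) (suc-injective len) ,
   AllP.map⁺ (All.zipWith (λ (range , s≢y) → reindex-range s-range range s≢y) (ys-range , s∉ys)) ,
   UniqueP.map⁻ (subst Unique (sym shift-reindexed) ys-unique)) ,
  s-range ,
  trans (cong canonical (sym (dropLast-top x xs))) (canonical-snoc s ys s∉ys)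
  where
    s : ℕ
    s = top (x ∷ xs)
    ys : List ℕ
    ys = dropLast (x ∷ xs)
    shift-reindexed : map (shiftLab s) (map (reindex s) ys) ≡ ys
    shift-reindexed = trans (sym (map-∘ ys)) (map-id-local (All.map shiftLab-reindex s∉ys))

prev-arrangement : ∀ {n c} → Arrangement (suc n) c → Arrangement n (prev c)
prev-arrangement arrangement = proj₁ (decompose arrangement)

top-range : ∀ {n c} → Arrangement (suc n) c → InRange (suc n) (top c)
top-range arrangement = proj₁ (proj₂ (decompose arrangement))

canonical-split : ∀ {n c} → Arrangement (suc n) c → canonical c ≡ canonical (prev c) ++ [ top c ]
canonical-split arrangement = proj₂ (proj₂ (decompose arrangement))

top-of-singleton : ∀ {c} → Arrangement 1 c → top c ≡ 1
top-of-singleton arrangement = ≤-antisym (proj₂ (top-range arrangement)) (proj₁ (top-range arrangement))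

canonical-of-singleton : ∀ {c} → Arrangement 1 c → canonical c ≡ [ 1 ]
canonical-of-singleton {c} arrangement with prev c | prev-arrangement arrangement | canonical-split arrangement
... | [] | _ | split = trans split (cong [_] (top-of-singleton arrangement))

module _ {A : Set} {R : A → A → Set} where

  linked-init : ∀ xs {y} → Linked R (xs ++ [ y ]) → Linked R xs
  linked-init []           _       = []
  linked-init (x ∷ [])     _       = [-]
  linked-init (x ∷ x′ ∷ xs) (r ∷ l) = r ∷ linked-init (x′ ∷ xs) l

  linked-last : ∀ xs {x y} → Linked R (xs ++ x ∷ y ∷ []) → R x y
  linked-last []       l = Linked.head l
  linked-last (_ ∷ xs) l = linked-last xs (Linked.tail l)

prev-sorted : ∀ {n c} → Arrangement (suc n) c → Linked _≤_ (canonical c) → Linked _≤_ (canonical (prev c))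
prev-sorted {c = c} arrangement sorted =
  linked-init (canonical (prev c)) (subst (Linked _≤_) (canonical-split arrangement) sorted)

-- In a nondecreasing canonical sequence the tops of c and prev c are its last two entries.
top-prev-≤ : ∀ {n c} → Arrangement (suc (suc n)) c → Linked _≤_ (canonical c) → top (prev c) ≤ top c
top-prev-≤ {c = c} arrangement sorted = linked-last (canonical (prev (prev c))) (subst (Linked _≤_) two-tops sorted)
  where
    open ≡-Reasoning
    two-tops : canonical c ≡ canonical (prev (prev c)) ++ top (prev c) ∷ top c ∷ []
    two-tops = begin
      canonical c                                               ≡⟨ canonical-split arrangement ⟩
      canonical (prev c) ++ [ top c ]                           ≡⟨ cong (_++ [ top c ]) (canonical-split (prev-arrangement arrangement)) ⟩
      (canonical (prev (prev c)) ++ [ top (prev c) ]) ++ [ top c ] ≡⟨ ++-assoc (canonical (prev (prev c))) _ _ ⟩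
      canonical (prev (prev c)) ++ top (prev c) ∷ top c ∷ []      ∎

data Position (s : ℕ) : ℕ → Set where
  below : ∀ {k} → k < s → Position s k
  at    : Position s s
  after : Position s (suc s)
  above : ∀ {j} → s < j → Position s (suc j)

position-beyond : ∀ {s k} → s < k → Position s k
position-beyond {k = suc j} (s≤s s≤j) with m≤n⇒m<n∨m≡n s≤j
... | inj₁ s<j  = above s<j
... | inj₂ refl = after

position : ∀ s k → Position s k
position s k with <-cmp k s
... | tri< k<s _ _  = below k<s
... | tri≈ _ refl _ = at
... | tri> _ _ s<k  = position-beyond s<k

profile-positive : ∀ t {c} → Arrangement (suc t) c → ∀ {q} → 1 ≤ q → q ≤ suc (suc t) → 0 < profile (𝒢 (suc t) c) q
profile-positive zero _ {suc zero}          _ _ = s≤s z≤n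
profile-positive zero _ {suc (suc zero)}    _ _ = s≤s z≤n
profile-positive zero _ {suc (suc (suc _))} _ (s≤s (s≤s ()))
profile-positive (suc t) {c} arrangement {q} 1≤q q≤ = by-position (position (top c) q) 1≤q q≤
  where
    G : Graph
    G = 𝒢 (suc t) (prev c)
    previous : ∀ {q} → 1 ≤ q → q ≤ suc (suc t) → 0 < profile G q
    previous = profile-positive t (prev-arrangement arrangement)
    1≤s : 1 ≤ top c
    1≤s = proj₁ (top-range arrangement)
    s≤ : top c ≤ suc (suc t)
    s≤ = proj₂ (top-range arrangement)
    by-position : ∀ {q} → Position (top c) q → 1 ≤ q → q ≤ suc (suc (suc t)) → 0 < profile (𝒢 (suc (suc t)) c) q
    by-position (below q<s) 1≤q _ =
      subst (0 <_) (sym (step-below G q<s)) (*-monoʳ-< 2 (previous 1≤q (<⇒≤ (<-≤-trans q<s s≤))))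
    by-position at _ _ = subst (0 <_) (sym (step-at G)) (previous 1≤s s≤)
    by-position after _ _ = subst (0 <_) (sym (step-after G)) (previous 1≤s s≤)
    by-position (above s<j) _ q≤ =
      subst (0 <_) (sym (step-above G s<j)) (*-monoʳ-< 2 (previous (≤-trans (s≤s z≤n) s<j) (≤-pred q≤)))

RisesAfter : (ℕ → ℕ) → ℕ → ℕ → Set
RisesAfter f p n = f p ≡ f (suc p) × (∀ {q} → p < q → q ≤ n → f q < f (suc q))

rises-weakly : ∀ {f p n q} → RisesAfter f p n → p ≤ q → q ≤ n → f q ≤ f (suc q)
rises-weakly (flat , strict) p≤q q≤n with m≤n⇒m<n∨m≡n p≤q
... | inj₁ p<q  = <⇒≤ (strict p<q q≤n)
... | inj₂ refl = ≤-reflexive flat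

below-double : ∀ {m n} → m ≤ n → 0 < n → m < 2 * n
below-double {m} {n} m≤n 0<n = subst (m <_) (twice n) (≤-<-trans m≤n (m<m+n n 0<n))

step-rises : ∀ G {p s n} → RisesAfter (profile G) p n → p ≤ s →
  (∀ {q} → 1 ≤ q → q ≤ suc n → 0 < profile G q) → RisesAfter (profile (step s G)) s (suc n)
step-rises G {p} {s} {n} rises p≤s positive = trans (step-at G) (sym (step-after G)) , λ s<q → by-position (position s _) s<q
  where
    g : ℕ → ℕ
    g = profile (step s G)
    by-position : ∀ {q} → Position s q → s < q → q ≤ suc n → g q < g (suc q)
    by-position (below q<s) s<q _ = ⊥-elim (<-asym q<s s<q)
    by-position at s<s _ = ⊥-elim (<-irrefl refl s<s)
    by-position after _ (s≤s s≤n) =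
      subst₂ _<_ (sym (step-after G)) (sym (step-above G (n<1+n s)))
        (below-double (rises-weakly rises p≤s s≤n) (positive (s≤s z≤n) (s≤s s≤n)))
    by-position (above s<j) _ (s≤s j≤n) =
      subst₂ _<_ (sym (step-above G s<j)) (sym (step-above G (m<n⇒m<1+n s<j)))
        (*-monoʳ-< 2 (proj₂ rises (≤-<-trans p≤s s<j) j≤n))

profile-rises : ∀ t {c} → Arrangement (suc t) c → Linked _≤_ (canonical c) →
  RisesAfter (profile (𝒢 (suc t) c)) (top c) (suc t)
profile-rises zero arrangement _ rewrite top-of-singleton arrangement = refl , λ 1<q q≤1 → ⊥-elim (<⇒≱ 1<q q≤1)
profile-rises (suc t) {c} arrangement sorted =
  step-rises (𝒢 (suc t) (prev c))
    (profile-rises t (prev-arrangement arrangement) (prev-sorted arrangement sorted))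
    (top-prev-≤ arrangement sorted)
    (profile-positive t (prev-arrangement arrangement))

differ-near : ∀ {f f′ : ℕ → ℕ} {m n} → 1 ≤ m → m ≤ n → (f m ≡ f′ m → f (suc m) ≢ f′ (suc m)) →
  ∃[ k ] (1 ≤ k × k ≤ suc n × f k ≢ f′ k)
differ-near {f} {f′} {m} 1≤m m≤n not-both with f m ≟ f′ m
... | no  differ = m , 1≤m , m≤n⇒m≤1+n m≤n , differ
... | yes agree  = suc m , s≤s z≤n , s≤s m≤n , not-both agree

-- Profiles rising after different tops differ: at the larger top one is flat
-- and the other strictly increasing.
tops-separate : ∀ {f f′ s s′ n} → RisesAfter f s n → RisesAfter f′ s′ n → s ≢ s′ → s ≤ n → s′ ≤ n →
  ∃[ k ] (1 ≤ k × k ≤ suc n × f k ≢ f′ k)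
tops-separate {s = s} {s′} (flat , strict) (flat′ , strict′) s≢s′ s≤n s′≤n with <-cmp s s′
... | tri< s<s′ _ _ = differ-near (≤-trans (s≤s z≤n) s<s′) s′≤n
                        λ e e′ → <⇒≢ (strict s<s′ s′≤n) (trans e (trans flat′ (sym e′)))
... | tri≈ _ s≡s′ _ = ⊥-elim (s≢s′ s≡s′)
... | tri> _ _ s′<s = differ-near (≤-trans (s≤s z≤n) s′<s) s≤n
                        λ e e′ → <⇒≢ (strict′ s′<s s≤n) (trans (sym e) (trans flat e′))

step-separates : ∀ G G′ {s s′ n} → s ≡ s′ →
  ∃[ k ] (1 ≤ k × k ≤ suc n × profile G k ≢ profile G′ k) →
  ∃[ k ] (1 ≤ k × k ≤ suc (suc n) × profile (step s G) k ≢ profile (step s′ G′) k)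
step-separates G G′ {s} refl (k , 1≤k , k≤ , differ) with <-cmp k s
... | tri< k<s _ _ = k , 1≤k , m≤n⇒m≤1+n k≤ ,
  λ e → differ (*-cancelˡ-≡ _ _ 2 (trans (sym (step-below G k<s)) (trans e (step-below G′ k<s))))
... | tri≈ _ refl _ = k , 1≤k , m≤n⇒m≤1+n k≤ ,
  λ e → differ (trans (sym (step-at G)) (trans e (step-at G′)))
... | tri> _ _ s<k = suc k , s≤s z≤n , s≤s k≤ ,
  λ e → differ (*-cancelˡ-≡ _ _ 2 (trans (sym (step-above G s<k)) (trans e (step-above G′ s<k))))

profiles-differ : ∀ t {c c′} → Arrangement (suc t) c → Arrangement (suc t) c′ →
  Linked _≤_ (canonical c) → Linked _≤_ (canonical c′) → canonical c ≢ canonical c′ →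
  ∃[ k ] (1 ≤ k × k ≤ suc (suc t) × profile (𝒢 (suc t) c) k ≢ profile (𝒢 (suc t) c′) k)
profiles-differ zero arrangement arrangement′ _ _ c≢c′ =
  ⊥-elim (c≢c′ (trans (canonical-of-singleton arrangement) (sym (canonical-of-singleton arrangement′))))
profiles-differ (suc t) {c} {c′} arrangement arrangement′ sorted sorted′ c≢c′ with top c ≟ top c′
... | no tops-differ =
  tops-separate (profile-rises (suc t) arrangement sorted) (profile-rises (suc t) arrangement′ sorted′)
    tops-differ (proj₂ (top-range arrangement)) (proj₂ (top-range arrangement′))
... | yes same-top =
  step-separates (𝒢 (suc t) (prev c)) (𝒢 (suc t) (prev c′)) same-top
    (profiles-differ t (prev-arrangement arrangement) (prev-arrangement arrangement′)
      (prev-sorted arrangement sorted) (prev-sorted arrangement′ sorted′) prev-differ)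
  where
    prev-differ : canonical (prev c) ≢ canonical (prev c′)
    prev-differ eq = c≢c′ (trans (canonical-split arrangement)
      (trans (cong₂ (λ xs s → xs ++ [ s ]) eq same-top) (sym (canonical-split arrangement′))))

lemma6p6 : (t : ℕ) → 1 ≤ t → (c c′ : LinOrder) → c ↭ oneTo t → c′ ↭ oneTo t →
    Linked _≤_ (canonical c) → Linked _≤_ (canonical c′) → canonical c ≢ canonical c′ →
    ∃[ k ] (1 ≤ k × k ≤ suc t × #vertices k (𝒢 t c) ≢ #vertices k (𝒢 t c′))
lemma6p6 (suc t) _ c c′ c↭ c′↭ sorted sorted′ c≢c′ =
  profiles-differ t (as-arrangement c↭) (as-arrangement c′↭) sorted sorted′ c≢c′
  where
    as-arrangement : ∀ {d} → d ↭ oneTo (suc t) → Arrangement (suc t) d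
    as-arrangement d↭ = arrangement-resp-↭ (↭-sym d↭) (oneTo-arrangement (suc t))
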